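{- Let $r\ge1$, let $R=\{\bm c^\ast_1,\dots,\bm c^\ast_r\}$ and let $B\ne R$ be a basis. Then $|\pi(B)\cap R|=|B\cap R|+1$.
   Context: Work in $GF(2)^r$. $\bm c^\ast_i$ is the vector with $i$-th entry 1 and others 0. A basis is a set of $r$ linearly independent vectors in $GF(2)^r$. For $\bm c=(c_1,\dots,c_r)$, $\mathrm{bin}(\bm c)$ is the integer with binary representation $c_1c_2\dots c_r$ ($c_1$ most significant), and $\bm c\prec\bm d$ iff $\mathrm{bin}(\bm c)<\mathrm{bin}(\bm d)$; $\min$ is taken with respect to $\prec$. For a basis $B$ and $\bm x\in B$, $\mathrm{Ex}_{\mathrm{in}}(B;\bm x)=\{\bm y\notin B: (B\setminus\{\bm x\})\cup\{\bm y\}\text{ is a basis}\}\cup\{\bm x\}$. For a basis $B\ne R$, with $\bm y'=\min(B\setminus R)$, the parent is $\pi(B)=(B\setminus\{\bm y'\})\cup\{\min(R\cap \mathrm{Ex}_{\mathrm{in}}(B;\bm y'))\}$ (this set $R\cap\mathrm{Ex}_{\mathrm{in}}(B;\bm y')$ is nonempty). -}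

module Defs where

open import Data.Bool using (Bool; true; false; _∧_; _∨_; not; _xor_; if_then_else_)
open import Data.Nat using (ℕ; zero; suc; _+_; _^_; _≤_)
open import Data.Fin using (Fin)
import Data.Fin as Fin
open import Data.List using (List; []; _∷_; _++_; map; foldr; filter; length; allFin)
open import Data.Bool.ListAction using (any)
open import Data.Vec using (Vec; []; _∷_; replicate; zipWith; tabulate)
open import Data.Vec.Properties using (≡-dec)
import Data.Bool.Properties as BoolP
open import Data.Product using (_×_)
open import Data.Sum using (_⊎_)
open import Relation.Nullary using (¬_; Dec; yes; no)
open import Relation.Nullary.Decidable using (⌊_⌋)
open import Relation.Binary.PropositionalEquality using (_≡_)

-- Vectors of GF(2)^r, with GF(2) = Bool (false = 0, true = 1, addition = xor).
GF2^ : ℕ → Set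
GF2^ r = Vec Bool r

_≟v_ : ∀ {r} → (u v : GF2^ r) → Dec (u ≡ v)
_≟v_ = ≡-dec BoolP._≟_

_⊕_ : ∀ {r} → GF2^ r → GF2^ r → GF2^ r
_⊕_ = zipWith _xor_

𝟎 : ∀ {r} → GF2^ r
𝟎 = replicate _ false

allVecs : (r : ℕ) → List (GF2^ r)
allVecs zero = [] ∷ []
allVecs (suc r) = map (false ∷_) (allVecs r) ++ map (true ∷_) (allVecs r)

Subset : ℕ → Set
Subset r = GF2^ r → Bool

_∈_ : ∀ {r} → GF2^ r → Subset r → Set
v ∈ S = S v ≡ true

_∩_ : ∀ {r} → Subset r → Subset r → Subset r
(S ∩ T) v = S v ∧ T v

_∖_ : ∀ {r} → Subset r → Subset r → Subset r
(S ∖ T) v = S v ∧ not (T v)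

replace : ∀ {r} → Subset r → GF2^ r → GF2^ r → Subset r
replace S x y v = (S v ∧ not ⌊ v ≟v x ⌋) ∨ ⌊ v ≟v y ⌋

card : ∀ {r} → Subset r → ℕ
card {r} S = length (filter (λ v → S v BoolP.≟ true) (allVecs r))

sumSet : ∀ {r} → Subset r → GF2^ r
sumSet {r} S = foldr (λ v acc → if S v then v ⊕ acc else acc) 𝟎 (allVecs r)

LinIndep : ∀ {r} → Subset r → Set
LinIndep S = ∀ (c : Subset _) → sumSet (λ v → c v ∧ S v) ≡ 𝟎 → ∀ v → v ∈ S → c v ≡ false

IsBasis : ∀ {r} → Subset r → Set
IsBasis {r} B = card B ≡ r × LinIndep B

unit : ∀ {r} → Fin r → GF2^ r
unit i = tabulate (λ j → ⌊ i Fin.≟ j ⌋)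

Rset : (r : ℕ) → Subset r
Rset r v = any (λ i → ⌊ v ≟v unit i ⌋) (allFin r)

-- bin(c) with c₁ most significant.
bit : Bool → ℕ
bit true = 1
bit false = 0

bin : ∀ {r} → GF2^ r → ℕ
bin [] = 0
bin {suc n} (b ∷ bs) = bit b * 2 ^ n + bin bs
  where open Data.Nat using (_*_)

ExIn : ∀ {r} → Subset r → GF2^ r → GF2^ r → Set
ExIn B x y = ((¬ (y ∈ B)) × IsBasis (replace B x y)) ⊎ (y ≡ x)

IsMin : ∀ {r} → (GF2^ r → Set) → GF2^ r → Set
IsMin P x = P x × (∀ z → P z → bin x ≤ bin z)

IsY' : ∀ {r} → Subset r → GF2^ r → Set
IsY' {r} B = IsMin (λ v → v ∈ (B ∖ Rset r))

IsX' : ∀ {r} → Subset r → GF2^ r → GF2^ r → Set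
IsX' {r} B y' = IsMin (λ v → v ∈ Rset r × ExIn B y' v)

parentOf : ∀ {r} → Subset r → GF2^ r → GF2^ r → Subset r
parentOf = replace

{-# OPTIONS --safe #-}
module Submission where

-- Write S = B ∖ {y'}.  Since B is independent, y' ∉ span S; as the unit vectors span
-- GF(2)^r, some c*_i lies outside span S.  For v ∉ B, (B ∖ {y'}) ∪ {v} is again a basis
-- exactly when v ∉ span S: if v ∈ span S it is dependent, otherwise it is independent of
-- size r.  So R ∩ Ex_in(B; y') = R ∖ span S is nonempty and has a ≺-least element x'.
-- Now x' ∈ R ∖ B (x' ≠ y' because y' ∉ R) while the removed y' is not in R, hence
-- π(B) ∩ R = (B ∩ R) ∪ {x'}.  Finally y' exists: B ⊆ R with |B| = r = |R| would force B = R.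

open import Defs
open import Data.Nat using (ℕ; _+_; _≤_)
open import Data.Product using (_×_; ∃₂)
open import Relation.Nullary using (¬_)
open import Relation.Binary.PropositionalEquality using (_≡_)

open import Algebra.Bundles using (AbelianGroup)
open import Algebra.Structures using (IsAbelianGroup)
open import Data.Bool using (Bool; true; false; _∧_; _∨_; not; _xor_; if_then_else_)
open import Data.Bool.Properties
  using ( xor-assoc; xor-comm; xor-identityˡ; xor-identityʳ; xor-same
        ; ∧-identityʳ; ∧-zeroʳ; ∨-identityʳ; ∨-zeroʳ; ∧-distribˡ-∨; ∧-distribʳ-xor; T-≡)
import Data.Bool.Properties as Bool
open import Data.Fin using (Fin)
import Data.Fin as Fin
open import Data.List using (List; []; _∷_; _++_; map; foldr; filter; length; allFin)
open import Data.List.Extrema.Nat using (argmin; argmin-all; f[argmin]≤f[⊤]; f[argmin]≤f[xs])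
open import Data.List.Membership.Propositional using (lose) renaming (_∈_ to _∈ˡ_)
open import Data.List.Membership.Propositional.Properties
  using (∈-map⁺; ∈-map⁻; ∈-++⁺ˡ; ∈-++⁺ʳ; ∈-allFin; ∈-filter⁺)
open import Data.List.Relation.Unary.All as All using (All; []; _∷_)
open import Data.List.Relation.Unary.All.Properties using (all-filter)
open import Data.List.Relation.Unary.AllPairs using ([]; _∷_)
open import Data.List.Relation.Unary.Any using (here; there; satisfied)
open import Data.List.Relation.Unary.Any.Properties using (any⁺; any⁻)
open import Data.List.Relation.Unary.Unique.Propositional using (Unique)
import Data.List.Relation.Unary.Unique.Propositional.Properties as Unique
open import Data.Nat using (zero; suc; _<_; z≤n; s≤s)
open import Data.Nat.Properties using (+-comm; m≤n⇒m≤1+n; <⇒≱; ≤-trans; ≤-reflexive)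
open import Data.Product using (∃; _,_; proj₁; proj₂)
import Data.Product as Product
open import Data.Sum using (_⊎_; inj₁; inj₂)
open import Data.Vec using ([]; _∷_)
open import Data.Vec.Properties
  using (∷-injectiveʳ; tabulate-cong; lookup-replicate; tabulate∘lookup
        ; zipWith-assoc; zipWith-comm; zipWith-identityˡ)
open import Function using (id; _∘_; _⇔_; mk⇔; Equivalence)
open import Function.Properties.Equivalence using () renaming (sym to ⇔-sym)
open import Relation.Binary.PropositionalEquality
  using ( refl; sym; trans; cong; cong₂; subst; subst₂; _≢_; ≢-sym; module ≡-Reasoning
        ; ≡-≟-identity; ≢-≟-identity)
open import Relation.Binary.PropositionalEquality.Algebra using (isMagma)
open import Relation.Nullary using (contradiction)
open import Relation.Nullary.Decidable
  using (Dec; isYes; yes; no; toWitness; fromWitness; _⊎-dec_; _×-dec_)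
import Relation.Nullary.Decidable as Dec
open import Relation.Unary using (Decidable)

private
  variable
    r : ℕ
    u v : GF2^ r
    S T U c : Subset r
    xs : List (GF2^ r)

-- GF(2)^r as an abelian group

⊕-assoc : (u v w : GF2^ r) → (u ⊕ v) ⊕ w ≡ u ⊕ (v ⊕ w)
⊕-assoc = zipWith-assoc xor-assoc

⊕-comm : (u v : GF2^ r) → u ⊕ v ≡ v ⊕ u
⊕-comm = zipWith-comm xor-comm

⊕-identityˡ : (u : GF2^ r) → 𝟎 ⊕ u ≡ u
⊕-identityˡ = zipWith-identityˡ xor-identityˡ

⊕-identityʳ : (u : GF2^ r) → u ⊕ 𝟎 ≡ u
⊕-identityʳ u = trans (⊕-comm u 𝟎) (⊕-identityˡ u)

⊕-self : (u : GF2^ r) → u ⊕ u ≡ 𝟎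
⊕-self [] = refl
⊕-self (b ∷ u) = cong₂ _∷_ (xor-same b) (⊕-self u)

⊕-isAbelianGroup : IsAbelianGroup _≡_ (_⊕_ {r}) 𝟎 id
⊕-isAbelianGroup = record
  { isGroup = record
    { isMonoid = record
      { isSemigroup = record { isMagma = isMagma _⊕_ ; assoc = ⊕-assoc }
      ; identity = ⊕-identityˡ , ⊕-identityʳ
      }
    ; inverse = ⊕-self , ⊕-self
    ; ⁻¹-cong = id
    }
  ; comm = ⊕-comm
  }

⊕-abelianGroup : ℕ → AbelianGroup _ _
⊕-abelianGroup r = record { isAbelianGroup = ⊕-isAbelianGroup {r} }

module ⊕-Properties {r : ℕ} where
  open import Algebra.Properties.AbelianGroup (⊕-abelianGroup r) public
  open import Algebra.Properties.CommutativeSemigroup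
    (AbelianGroup.commutativeSemigroup (⊕-abelianGroup r)) public

open ⊕-Properties using (x∙yz≈y∙xz; interchange; x∙y⁻¹≈ε⇒x≈y; \\-leftDividesʳ)

xa⊕xb≡a⊕b : (x a b : GF2^ r) → (x ⊕ a) ⊕ (x ⊕ b) ≡ a ⊕ b
xa⊕xb≡a⊕b x a b = begin
  (x ⊕ a) ⊕ (x ⊕ b)  ≡⟨ interchange x a x b ⟩
  (x ⊕ x) ⊕ (a ⊕ b)  ≡⟨ cong (_⊕ (a ⊕ b)) (⊕-self x) ⟩
  𝟎 ⊕ (a ⊕ b)        ≡⟨ ⊕-identityˡ (a ⊕ b) ⟩
  a ⊕ b              ∎
  where open ≡-Reasoning

infixr 7 _△_
infixr 6 _∪_
infix 4 _⊆_ _≐_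

｛_｝ : GF2^ r → Subset r
｛ u ｝ v = isYes (v ≟v u)

_∪_ : Subset r → Subset r → Subset r
(S ∪ T) v = S v ∨ T v

_△_ : Subset r → Subset r → Subset r
(S △ T) v = S v xor T v

_⊆_ : Subset r → Subset r → Set
S ⊆ T = ∀ {v} → v ∈ S → v ∈ T

_≐_ : Subset r → Subset r → Set
S ≐ T = ∀ v → S v ≡ T v

∈｛｝ : (u : GF2^ r) → u ∈ ｛ u ｝
∈｛｝ u = cong isYes (≡-≟-identity _≟v_ refl)

∉｛｝ : v ≢ u → ｛ u ｝ v ≡ false
∉｛｝ v≢u = cong isYes (≢-≟-identity _≟v_ v≢u)

∈｛｝⇒≡ : v ∈ ｛ u ｝ → v ≡ u
∈｛｝⇒≡ = toWitness ∘ Equivalence.from T-≡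

∧≡true⇒ : ∀ {a b} → a ∧ b ≡ true → a ≡ true × b ≡ true
∧≡true⇒ {true} {true} _ = refl , refl

∨≡true⇒ : ∀ {a b} → a ∨ b ≡ true → a ≡ true ⊎ b ≡ true
∨≡true⇒ {true} _ = inj₁ refl
∨≡true⇒ {false} b≡true = inj₂ b≡true

∩-⊆ʳ : c ∩ S ⊆ S
∩-⊆ʳ = proj₂ ∘ ∧≡true⇒

⊆⇒∩≐ : S ⊆ T → S ∩ T ≐ S
⊆⇒∩≐ {S = S} S⊆T v with S v in Sv
... | true  = S⊆T Sv
... | false = refl

⊆-antisym : S ⊆ T → T ⊆ S → S ≐ T
⊆-antisym S⊆T T⊆S v = Bool.⇔→≡ (mk⇔ S⊆T T⊆S)

≐⇒⊆ : S ≐ T → S ⊆ T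
≐⇒⊆ S≐T v∈S = trans (sym (S≐T _)) v∈S

∪-monoˡ-⊆ : S ⊆ T → S ∪ U ⊆ T ∪ U
∪-monoˡ-⊆ {T = T} S⊆T v∈S∪U with ∨≡true⇒ v∈S∪U
... | inj₁ v∈S = cong (_∨ _) (S⊆T v∈S)
... | inj₂ v∈U = trans (cong (T _ ∨_) v∈U) (∨-zeroʳ (T _))

∈∖⇒ : v ∈ (S ∖ T) → v ∈ S × T v ≡ false
∈∖⇒ {v = v} {S = S} {T = T} v∈S∖T with S v | T v | v∈S∖T
... | true | false | _ = refl , refl

∈∖｛｝ : v ∈ S → v ≢ u → v ∈ (S ∖ ｛ u ｝)
∈∖｛｝ v∈S v≢u = cong₂ (λ a b → a ∧ not b) v∈S (∉｛｝ v≢u)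

∖｛｝-∌ : (S : Subset r) (u : GF2^ r) → (S ∖ ｛ u ｝) u ≡ false
∖｛｝-∌ S u = trans (cong (λ b → S u ∧ not b) (∈｛｝ u)) (∧-zeroʳ (S u))

∖｛｝-⊆ : S ∖ ｛ u ｝ ⊆ S
∖｛｝-⊆ {S = S} {u = u} = proj₁ ∘ ∈∖⇒ {S = S} {T = ｛ u ｝}

∪｛｝-∋ : (S : Subset r) (u : GF2^ r) → u ∈ (S ∪ ｛ u ｝)
∪｛｝-∋ S u = trans (cong (S u ∨_) (∈｛｝ u)) (∨-zeroʳ (S u))

∖｛｝-∪｛｝ : u ∈ S → (S ∖ ｛ u ｝) ∪ ｛ u ｝ ≐ S
∖｛｝-∪｛｝ {u = u} {S = S} u∈S v with v ≟v u
... | yes refl = trans (∨-zeroʳ _) (sym u∈S)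
... | no _     = trans (∨-identityʳ _) (∧-identityʳ (S v))

∪｛｝≐△｛｝ : S u ≡ false → S ∪ ｛ u ｝ ≐ S △ ｛ u ｝
∪｛｝≐△｛｝ {S = S} {u = u} Su v with v ≟v u
... | yes refl rewrite Su = refl
... | no _     = trans (∨-identityʳ (S v)) (sym (xor-identityʳ (S v)))

-- For a literal b the right-hand side reduces to (c ∩ S) ∪ ｛ u ｝ (b = true) or to
-- (c ∩ S) ∪ ∅ (b = false).
∩-∪｛｝ : ∀ {b} → c u ≡ b → c ∩ (S ∪ ｛ u ｝) ≐ (c ∩ S) ∪ (λ v → b ∧ ｛ u ｝ v)
∩-∪｛｝ {c = c} {u = u} {S = S} cu v =
  trans (∧-distribˡ-∨ (c v) (S v) (｛ u ｝ v)) (cong ((c v ∧ S v) ∨_) c∩｛u｝)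
  where
  c∩｛u｝ : c v ∧ ｛ u ｝ v ≡ _ ∧ ｛ u ｝ v
  c∩｛u｝ with v ≟v u
  ... | yes refl = cong (_∧ true) cu
  ... | no _     = trans (∧-zeroʳ (c v)) (sym (∧-zeroʳ _))

-- Sums and cardinalities

allVecs-complete : (v : GF2^ r) → v ∈ˡ allVecs r
allVecs-complete [] = here refl
allVecs-complete {suc r} (false ∷ v) = ∈-++⁺ˡ (∈-map⁺ (false ∷_) (allVecs-complete v))
allVecs-complete {suc r} (true ∷ v) =
  ∈-++⁺ʳ (map (false ∷_) (allVecs r)) (∈-map⁺ (true ∷_) (allVecs-complete v))

allVecs-unique : (r : ℕ) → Unique (allVecs r)
allVecs-unique zero = [] ∷ []
allVecs-unique (suc r) =
  Unique.++⁺ (Unique.map⁺ ∷-injectiveʳ (allVecs-unique r))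
             (Unique.map⁺ ∷-injectiveʳ (allVecs-unique r))
             heads-differ
  where
  heads-differ : ∀ {v} → ¬ (v ∈ˡ map (false ∷_) (allVecs r) × v ∈ˡ map (true ∷_) (allVecs r))
  heads-differ (v∈₀ , v∈₁) with ∈-map⁻ (false ∷_) v∈₀ | ∈-map⁻ (true ∷_) v∈₁
  ... | _ , _ , refl | _ , _ , ()

-- sumSet S is sumOn S (allVecs r) by definition.
sumOn : Subset r → List (GF2^ r) → GF2^ r
sumOn S = foldr (λ v acc → if S v then v ⊕ acc else acc) 𝟎

cardOn : Subset r → List (GF2^ r) → ℕ
cardOn S = foldr (λ v n → if S v then suc n else n) 0

card≡cardOn : (S : Subset r) → card S ≡ cardOn S (allVecs r)
card≡cardOn {r} S = go (allVecs r)
  where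
  go : (xs : List (GF2^ r)) → length (filter (λ v → S v Bool.≟ true) xs) ≡ cardOn S xs
  go [] = refl
  go (x ∷ xs) with S x
  ... | true  = cong suc (go xs)
  ... | false = go xs

sumOn-congᴬ : All (λ v → S v ≡ T v) xs → sumOn S xs ≡ sumOn T xs
sumOn-congᴬ [] = refl
sumOn-congᴬ {xs = x ∷ _} (Sx≡Tx ∷ eqs) =
  cong₂ (λ b acc → if b then x ⊕ acc else acc) Sx≡Tx (sumOn-congᴬ eqs)

sumOn-∅ : (xs : List (GF2^ r)) → sumOn (λ _ → false) xs ≡ 𝟎
sumOn-∅ [] = refl
sumOn-∅ (_ ∷ xs) = sumOn-∅ xs

sumOn-△ : (S T : Subset r) (xs : List (GF2^ r)) → sumOn (S △ T) xs ≡ sumOn S xs ⊕ sumOn T xs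
sumOn-△ S T [] = sym (⊕-identityˡ 𝟎)
sumOn-△ S T (x ∷ xs) with S x | T x | sumOn-△ S T xs
... | true  | true  | ih = trans ih (sym (xa⊕xb≡a⊕b x _ _))
... | true  | false | ih = trans (cong (x ⊕_) ih) (sym (⊕-assoc x _ _))
... | false | true  | ih = trans (cong (x ⊕_) ih) (x∙yz≈y∙xz x _ _)
... | false | false | ih = ih

sumOn-｛｝ : Unique xs → u ∈ˡ xs → sumOn ｛ u ｝ xs ≡ u
sumOn-｛｝ {xs = u ∷ xs} (u∉xs ∷ _) (here refl) rewrite ∈｛｝ u = begin
  u ⊕ sumOn ｛ u ｝ xs
    ≡⟨ cong (u ⊕_) (sumOn-congᴬ (All.map (∉｛｝ ∘ ≢-sym) u∉xs)) ⟩
  u ⊕ sumOn (λ _ → false) xs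
    ≡⟨ cong (u ⊕_) (sumOn-∅ xs) ⟩
  u ⊕ 𝟎
    ≡⟨ ⊕-identityʳ u ⟩
  u
    ∎
  where open ≡-Reasoning
sumOn-｛｝ (x∉xs ∷ unique) (there u∈xs) rewrite ∉｛｝ (All.lookup x∉xs u∈xs) =
  sumOn-｛｝ unique u∈xs

cardOn-congᴬ : All (λ v → S v ≡ T v) xs → cardOn S xs ≡ cardOn T xs
cardOn-congᴬ [] = refl
cardOn-congᴬ (Sx≡Tx ∷ eqs) =
  cong₂ (λ b n → if b then suc n else n) Sx≡Tx (cardOn-congᴬ eqs)

cardOn-∅ : (xs : List (GF2^ r)) → cardOn (λ _ → false) xs ≡ 0
cardOn-∅ [] = refl
cardOn-∅ (_ ∷ xs) = cardOn-∅ xs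

cardOn-∪｛｝ : S u ≡ false → Unique xs → u ∈ˡ xs →
             cardOn (S ∪ ｛ u ｝) xs ≡ suc (cardOn S xs)
cardOn-∪｛｝ {S = S} {u = u} Su (u∉xs ∷ _) (here refl) rewrite Su | ∈｛｝ u =
  cong suc (cardOn-congᴬ (All.map (λ u≢v → trans (cong (S _ ∨_) (∉｛｝ (≢-sym u≢v))) (∨-identityʳ _))
                                  u∉xs))
cardOn-∪｛｝ {S = S} {xs = x ∷ _} Su (x∉xs ∷ unique) (there u∈xs)
  rewrite ∉｛｝ (All.lookup x∉xs u∈xs) with S x
... | true  = cong suc (cardOn-∪｛｝ Su unique u∈xs)
... | false = cardOn-∪｛｝ Su unique u∈xs

cardOn-mono : S ⊆ T → (xs : List (GF2^ r)) → cardOn S xs ≤ cardOn T xs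
cardOn-mono S⊆T [] = z≤n
cardOn-mono {S = S} {T = T} S⊆T (x ∷ xs) with S x in Sx | T x in Tx
... | true  | true  = s≤s (cardOn-mono S⊆T xs)
... | true  | false = contradiction (trans (sym (S⊆T Sx)) Tx) λ ()
... | false | true  = m≤n⇒m≤1+n (cardOn-mono S⊆T xs)
... | false | false = cardOn-mono S⊆T xs

cardOn-++ : (S : Subset r) (xs ys : List (GF2^ r)) → cardOn S (xs ++ ys) ≡ cardOn S xs + cardOn S ys
cardOn-++ S [] ys = refl
cardOn-++ S (x ∷ xs) ys with S x
... | true  = cong suc (cardOn-++ S xs ys)
... | false = cardOn-++ S xs ys

cardOn-map : ∀ {s} (S : Subset r) (f : GF2^ s → GF2^ r) (xs : List (GF2^ s)) →
             cardOn S (map f xs) ≡ cardOn (S ∘ f) xs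
cardOn-map S f [] = refl
cardOn-map S f (x ∷ xs) with S (f x)
... | true  = cong suc (cardOn-map S f xs)
... | false = cardOn-map S f xs

sumSet-cong : S ≐ T → sumSet S ≡ sumSet T
sumSet-cong {r} S≐T = sumOn-congᴬ (All.universal S≐T (allVecs r))

sumSet-△ : (S T : Subset r) → sumSet (S △ T) ≡ sumSet S ⊕ sumSet T
sumSet-△ {r} S T = sumOn-△ S T (allVecs r)

sumSet-｛｝ : (u : GF2^ r) → sumSet ｛ u ｝ ≡ u
sumSet-｛｝ {r} u = sumOn-｛｝ (allVecs-unique r) (allVecs-complete u)

sumSet-∪｛｝ : S u ≡ false → sumSet (S ∪ ｛ u ｝) ≡ sumSet S ⊕ u
sumSet-∪｛｝ {S = S} {u} Su = begin
  sumSet (S ∪ ｛ u ｝)          ≡⟨ sumSet-cong (∪｛｝≐△｛｝ Su) ⟩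
  sumSet (S △ ｛ u ｝)          ≡⟨ sumSet-△ S ｛ u ｝ ⟩
  sumSet S ⊕ sumSet ｛ u ｝     ≡⟨ cong (sumSet S ⊕_) (sumSet-｛｝ u) ⟩
  sumSet S ⊕ u                 ∎
  where open ≡-Reasoning

card-cong : S ≐ T → card S ≡ card T
card-cong {r} {S = S} {T = T} S≐T = begin
  card S                   ≡⟨ card≡cardOn S ⟩
  cardOn S (allVecs r)     ≡⟨ cardOn-congᴬ (All.universal S≐T (allVecs r)) ⟩
  cardOn T (allVecs r)     ≡⟨ card≡cardOn T ⟨
  card T                   ∎
  where open ≡-Reasoning

card-∪｛｝ : S u ≡ false → card (S ∪ ｛ u ｝) ≡ suc (card S)
card-∪｛｝ {r} {S = S} {u = u} Su = begin
  card (S ∪ ｛ u ｝)                ≡⟨ card≡cardOn (S ∪ ｛ u ｝) ⟩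
  cardOn (S ∪ ｛ u ｝) (allVecs r)  ≡⟨ cardOn-∪｛｝ Su (allVecs-unique r) (allVecs-complete u) ⟩
  suc (cardOn S (allVecs r))       ≡⟨ cong suc (card≡cardOn S) ⟨
  suc (card S)                     ∎
  where open ≡-Reasoning

card-∖｛｝ : u ∈ S → card S ≡ suc (card (S ∖ ｛ u ｝))
card-∖｛｝ {u = u} {S = S} u∈S =
  trans (card-cong {S = S} (sym ∘ ∖｛｝-∪｛｝ u∈S))
        (card-∪｛｝ {S = S ∖ ｛ u ｝} (∖｛｝-∌ S u))

card-mono : S ⊆ T → card S ≤ card T
card-mono {r} {S = S} {T = T} S⊆T =
  subst₂ _≤_ (sym (card≡cardOn S)) (sym (card≡cardOn T)) (cardOn-mono S⊆T (allVecs r))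

card-∅ : card {r} (λ _ → false) ≡ 0
card-∅ {r} = trans (card≡cardOn {r} (λ _ → false)) (cardOn-∅ (allVecs r))

card-｛｝ : (u : GF2^ r) → card ｛ u ｝ ≡ 1
card-｛｝ {r} u = trans (card-∪｛｝ {S = λ _ → false} {u = u} refl) (cong suc (card-∅ {r}))

card-split : (S : Subset (suc r)) → card S ≡ card (S ∘ (false ∷_)) + card (S ∘ (true ∷_))
card-split {r} S = begin
  card S
    ≡⟨ card≡cardOn S ⟩
  cardOn S (map (false ∷_) (allVecs r) ++ map (true ∷_) (allVecs r))
    ≡⟨ cardOn-++ S (map (false ∷_) (allVecs r)) _ ⟩
  cardOn S (map (false ∷_) (allVecs r)) + cardOn S (map (true ∷_) (allVecs r))
    ≡⟨ cong₂ _+_ (cardOn-map S _ (allVecs r)) (cardOn-map S _ (allVecs r)) ⟩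
  cardOn (S ∘ (false ∷_)) (allVecs r) + cardOn (S ∘ (true ∷_)) (allVecs r)
    ≡⟨ cong₂ _+_ (card≡cardOn (S ∘ (false ∷_))) (card≡cardOn (S ∘ (true ∷_))) ⟨
  card (S ∘ (false ∷_)) + card (S ∘ (true ∷_))
    ∎
  where open ≡-Reasoning

⊆∧card≥⇒⊇ : S ⊆ T → card T ≤ card S → T ⊆ S
⊆∧card≥⇒⊇ {S = S} {T = T} S⊆T |T|≤|S| {v} v∈T with S v in Sv
... | true  = refl
... | false = contradiction |T|≤|S| (<⇒≱ |S|<|T|)
  where
  S⊆T∖v : S ⊆ T ∖ ｛ v ｝
  S⊆T∖v w∈S = ∈∖｛｝ {S = T} (S⊆T w∈S) λ { refl → contradiction (trans (sym w∈S) Sv) λ () }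
  |S|<|T| : card S < card T
  |S|<|T| = ≤-trans (s≤s (card-mono {S = S} {T = T ∖ ｛ v ｝} S⊆T∖v))
                    (≤-reflexive (sym (card-∖｛｝ {S = T} v∈T)))

card-replace-∩ : T u ≡ false → v ∈ T → S v ≡ false →
                 card (replace S u v ∩ T) ≡ card (S ∩ T) + 1
card-replace-∩ {T = T} {u = u} {v = v} {S = S} Tu v∈T Sv = begin
  card (replace S u v ∩ T)    ≡⟨ card-cong replace-∩ ⟩
  card ((S ∩ T) ∪ ｛ v ｝)     ≡⟨ card-∪｛｝ {S = S ∩ T} (cong (_∧ T v) Sv) ⟩
  suc (card (S ∩ T))          ≡⟨ +-comm 1 _ ⟩
  card (S ∩ T) + 1            ∎
  where
  open ≡-Reasoning
  replace-∩ : replace S u v ∩ T ≐ (S ∩ T) ∪ ｛ v ｝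
  replace-∩ w with w ≟v v | w ≟v u
  ... | yes refl | _        = trans (cong₂ _∧_ (∨-zeroʳ _) v∈T) (sym (∨-zeroʳ _))
  ... | no _     | yes refl rewrite Tu | ∧-zeroʳ (S u) = refl
  ... | no _     | no _     =
    trans (cong (_∧ T w) (trans (∨-identityʳ _) (∧-identityʳ (S w)))) (sym (∨-identityʳ _))

unit-zero : unit {suc r} Fin.zero ≡ true ∷ 𝟎
unit-zero =
  cong (true ∷_) (trans (tabulate-cong (λ i → sym (lookup-replicate i false))) (tabulate∘lookup 𝟎))

unit-suc : (i : Fin r) → unit (Fin.suc i) ≡ false ∷ unit i
unit-suc i = cong (false ∷_) (tabulate-cong isYes-suc≟suc)
  where
  isYes-suc≟suc : ∀ j → isYes (Fin.suc i Fin.≟ Fin.suc j) ≡ isYes (i Fin.≟ j)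
  isYes-suc≟suc j with i Fin.≟ j
  ... | yes _ = refl
  ... | no _  = refl

Rset-unit : (i : Fin r) → unit i ∈ Rset r
Rset-unit i = Equivalence.to T-≡ (any⁺ _ (lose (∈-allFin i) (fromWitness refl)))

Rset⇒unit : v ∈ Rset r → ∃ λ i → v ≡ unit i
Rset⇒unit {r} v∈R = Product.map₂ toWitness (satisfied (any⁻ _ (allFin r) (Equivalence.from T-≡ v∈R)))

Rset-false∷ : (v : GF2^ r) → Rset (suc r) (false ∷ v) ≡ Rset r v
Rset-false∷ {r} v = Bool.⇔→≡ (mk⇔ to from)
  where
  to : (false ∷ v) ∈ Rset (suc r) → v ∈ Rset r
  to v∈R with Rset⇒unit {v = false ∷ v} v∈R
  ... | Fin.zero  , eq = contradiction (trans eq (unit-zero {r})) λ ()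
  ... | Fin.suc i , eq = subst (_∈ Rset r) (sym (∷-injectiveʳ (trans eq (unit-suc i)))) (Rset-unit i)
  from : v ∈ Rset r → (false ∷ v) ∈ Rset (suc r)
  from v∈R with Rset⇒unit {v = v} v∈R
  ... | i , refl = subst (_∈ Rset (suc r)) (unit-suc i) (Rset-unit (Fin.suc i))

Rset-true∷ : (v : GF2^ r) → Rset (suc r) (true ∷ v) ≡ ｛ 𝟎 ｝ v
Rset-true∷ {r} v = Bool.⇔→≡ (mk⇔ to from)
  where
  to : (true ∷ v) ∈ Rset (suc r) → v ∈ ｛ 𝟎 ｝
  to v∈R with Rset⇒unit {v = true ∷ v} v∈R
  ... | Fin.zero  , eq =
    subst (_∈ ｛ 𝟎 ｝) (sym (∷-injectiveʳ (trans eq (unit-zero {r})))) (∈｛｝ 𝟎)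
  ... | Fin.suc i , eq = contradiction (trans eq (unit-suc i)) λ ()
  from : v ∈ ｛ 𝟎 ｝ → (true ∷ v) ∈ Rset (suc r)
  from v∈｛𝟎｝ rewrite ∈｛｝⇒≡ v∈｛𝟎｝ =
    subst (_∈ Rset (suc r)) (unit-zero {r}) (Rset-unit {suc r} Fin.zero)

card-Rset : (r : ℕ) → card (Rset r) ≡ r
card-Rset zero = refl
card-Rset (suc r) = begin
  card (Rset (suc r))
    ≡⟨ card-split (Rset (suc r)) ⟩
  card (Rset (suc r) ∘ (false ∷_)) + card (Rset (suc r) ∘ (true ∷_))
    ≡⟨ cong₂ _+_ (card-cong {r} Rset-false∷) (card-cong {r} Rset-true∷) ⟩
  card (Rset r) + card ｛ 𝟎 {r} ｝
    ≡⟨ cong₂ _+_ (card-Rset r) (card-｛｝ {r} 𝟎) ⟩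
  r + 1
    ≡⟨ +-comm r 1 ⟩
  suc r
    ∎
  where open ≡-Reasoning

-- Spans and linear independence

SpanOn : Subset r → List (GF2^ r) → GF2^ r → Set
SpanOn S xs v = ∃ λ c → sumOn (c ∩ S) xs ≡ v

Span : Subset r → GF2^ r → Set
Span {r} S = SpanOn S (allVecs r)

SpanOn-∷ : ∀ {x} → All (x ≢_) xs →
           SpanOn S (x ∷ xs) v ⇔ (SpanOn S xs v ⊎ (x ∈ S × SpanOn S xs (x ⊕ v)))
SpanOn-∷ {xs = xs} {S = S} {v = v} {x} x∉xs = mk⇔ to from
  where
  step : Bool → GF2^ _ → GF2^ _
  step b acc = if b then x ⊕ acc else acc
  to : SpanOn S (x ∷ xs) v → SpanOn S xs v ⊎ (x ∈ S × SpanOn S xs (x ⊕ v))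
  to (c , Σ≡v) with c x | S x
  ... | true  | true  = inj₂ (refl , c , trans (sym (\\-leftDividesʳ x _)) (cong (x ⊕_) Σ≡v))
  ... | true  | false = inj₁ (c , Σ≡v)
  ... | false | _     = inj₁ (c , Σ≡v)
  from : SpanOn S xs v ⊎ (x ∈ S × SpanOn S xs (x ⊕ v)) → SpanOn S (x ∷ xs) v
  from (inj₁ (c , Σ≡v)) = c ∖ ｛ x ｝ , cong₂ step head (trans tail Σ≡v)
    where
    head : (c x ∧ not (｛ x ｝ x)) ∧ S x ≡ false
    head = cong (_∧ S x) (∖｛｝-∌ c x)
    agree : ∀ {w} → x ≢ w → (c w ∧ not (｛ x ｝ w)) ∧ S w ≡ c w ∧ S w
    agree {w} x≢w =
      cong (_∧ S w) (trans (cong (λ b → c w ∧ not b) (∉｛｝ (≢-sym x≢w))) (∧-identityʳ (c w)))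
    tail : sumOn ((c ∖ ｛ x ｝) ∩ S) xs ≡ sumOn (c ∩ S) xs
    tail = sumOn-congᴬ (All.map agree x∉xs)
  from (inj₂ (x∈S , c , Σ≡x⊕v)) =
    c ∪ ｛ x ｝ , trans (cong₂ step head (trans tail Σ≡x⊕v)) (\\-leftDividesʳ x v)
    where
    head : (c x ∨ ｛ x ｝ x) ∧ S x ≡ true
    head = cong₂ _∧_ (∪｛｝-∋ c x) x∈S
    agree : ∀ {w} → x ≢ w → (c w ∨ ｛ x ｝ w) ∧ S w ≡ c w ∧ S w
    agree {w} x≢w =
      cong (_∧ S w) (trans (cong (c w ∨_) (∉｛｝ (≢-sym x≢w))) (∨-identityʳ (c w)))
    tail : sumOn ((c ∪ ｛ x ｝) ∩ S) xs ≡ sumOn (c ∩ S) xs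
    tail = sumOn-congᴬ (All.map agree x∉xs)

SpanOn? : (S : Subset r) → Unique xs → (v : GF2^ r) → Dec (SpanOn S xs v)
SpanOn? S [] v = Dec.map′ (λ 𝟎≡v → (λ _ → false) , 𝟎≡v) proj₂ (𝟎 ≟v v)
SpanOn? {xs = x ∷ _} S (x∉xs ∷ unique) v = Dec.map (⇔-sym (SpanOn-∷ x∉xs))
  (SpanOn? S unique v ⊎-dec (S x Bool.≟ true) ×-dec SpanOn? S unique (x ⊕ v))

Span? : (S : Subset r) (v : GF2^ r) → Dec (Span S v)
Span? {r} S = SpanOn? S (allVecs-unique r)

span-𝟎 : (S : Subset r) → Span S 𝟎
span-𝟎 {r} S = (λ _ → false) , sumOn-∅ (allVecs r)

span-⊕ : Span S u → Span S v → Span S (u ⊕ v)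
span-⊕ {S = S} (c , Σc≡u) (d , Σd≡v) = c △ d , (begin
  sumSet ((c △ d) ∩ S)          ≡⟨ sumSet-cong (λ w → ∧-distribʳ-xor (S w) (c w) (d w)) ⟩
  sumSet ((c ∩ S) △ (d ∩ S))    ≡⟨ sumSet-△ (c ∩ S) (d ∩ S) ⟩
  sumSet (c ∩ S) ⊕ sumSet (d ∩ S) ≡⟨ cong₂ _⊕_ Σc≡u Σd≡v ⟩
  _ ∎)
  where open ≡-Reasoning

∈⇒span : v ∈ S → Span S v
∈⇒span {v = v} {S = S} v∈S = ｛ v ｝ , trans (sumSet-cong (⊆⇒∩≐ ｛v｝⊆S)) (sumSet-｛｝ v)
  where
  ｛v｝⊆S : ｛ v ｝ ⊆ S
  ｛v｝⊆S w∈｛v｝ rewrite ∈｛｝⇒≡ w∈｛v｝ = v∈S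

unit-induction : (P : GF2^ r → Set) → P 𝟎 → (∀ {u v} → P u → P v → P (u ⊕ v)) →
                 (∀ i → P (unit i)) → ∀ v → P v
unit-induction {zero} P P𝟎 P⊕ Punit [] = P𝟎
unit-induction {suc r} P P𝟎 P⊕ Punit = by-head
  where
  P-tail : ∀ v → P (false ∷ v)
  P-tail = unit-induction (P ∘ (false ∷_)) P𝟎 P⊕ (λ i → subst P (unit-suc i) (Punit (Fin.suc i)))
  by-head : ∀ v → P v
  by-head (false ∷ v) = P-tail v
  by-head (true ∷ v) =
    subst P (cong (true ∷_) (⊕-identityˡ v)) (P⊕ (subst P unit-zero (Punit Fin.zero)) (P-tail v))

span-units⇒span-all : (∀ i → Span S (unit i)) → ∀ v → Span S v
span-units⇒span-all {S = S} = unit-induction (Span S) (span-𝟎 S) span-⊕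

LinIndep-⊆ : S ⊆ T → LinIndep T → LinIndep S
LinIndep-⊆ {S = S} {T = T} S⊆T T-indep c Σ≡𝟎 v v∈S =
  trans (sym (∧-identityʳ (c v)))
        (subst (λ b → c v ∧ b ≡ false) v∈S (T-indep (c ∩ S) Σ'≡𝟎 v (S⊆T v∈S)))
  where
  Σ'≡𝟎 : sumSet ((c ∩ S) ∩ T) ≡ 𝟎
  Σ'≡𝟎 = trans (sumSet-cong (⊆⇒∩≐ (λ w∈c∩S → S⊆T (∩-⊆ʳ {c = c} {S = S} w∈c∩S)))) Σ≡𝟎

span⇒dependent : Span S v → S v ≡ false → ¬ LinIndep (S ∪ ｛ v ｝)
span⇒dependent {S = S} {v = v} (c , Σ≡v) v∉S indep =
  contradiction (trans (sym (∪｛｝-∋ (c ∩ S) v)) (indep d Σ≡𝟎 v (∪｛｝-∋ S v))) λ ()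
  where
  d : Subset _
  d = (c ∩ S) ∪ ｛ v ｝
  d⊆S∪v : d ⊆ S ∪ ｛ v ｝
  d⊆S∪v = ∪-monoˡ-⊆ {S = c ∩ S} {T = S} {U = ｛ v ｝} (∩-⊆ʳ {c = c} {S = S})
  Σ≡𝟎 : sumSet (d ∩ (S ∪ ｛ v ｝)) ≡ 𝟎
  Σ≡𝟎 = begin
    sumSet (d ∩ (S ∪ ｛ v ｝))  ≡⟨ sumSet-cong (⊆⇒∩≐ d⊆S∪v) ⟩
    sumSet d                   ≡⟨ sumSet-∪｛｝ {S = c ∩ S} (trans (cong (c v ∧_) v∉S) (∧-zeroʳ (c v))) ⟩
    sumSet (c ∩ S) ⊕ v         ≡⟨ cong (_⊕ v) Σ≡v ⟩
    v ⊕ v                      ≡⟨ ⊕-self v ⟩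
    𝟎                          ∎
    where open ≡-Reasoning

LinIndep-∪｛｝ : LinIndep S → ¬ Span S v → LinIndep (S ∪ ｛ v ｝)
LinIndep-∪｛｝ {S = S} {v = v} S-indep v∉span c Σ≡𝟎 w w∈S∪v with c v in cv
... | true = contradiction (c , x∙y⁻¹≈ε⇒x≈y _ v Σc∩S⊕v≡𝟎) v∉span
  where
  Σc∩S⊕v≡𝟎 : sumSet (c ∩ S) ⊕ v ≡ 𝟎
  Σc∩S⊕v≡𝟎 = begin
    sumSet (c ∩ S) ⊕ v          ≡⟨ sumSet-∪｛｝ {S = c ∩ S} c∩S∌v ⟨
    sumSet ((c ∩ S) ∪ ｛ v ｝)   ≡⟨ sumSet-cong (∩-∪｛｝ {c = c} {S = S} cv) ⟨
    sumSet (c ∩ (S ∪ ｛ v ｝))   ≡⟨ Σ≡𝟎 ⟩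
    𝟎                           ∎
    where
    open ≡-Reasoning
    c∩S∌v : c v ∧ S v ≡ false
    c∩S∌v = trans (cong (c v ∧_) (Bool.¬-not (v∉span ∘ ∈⇒span))) (∧-zeroʳ (c v))
... | false with ∨≡true⇒ w∈S∪v
...   | inj₂ w∈｛v｝ = subst (λ u → c u ≡ false) (sym (∈｛｝⇒≡ w∈｛v｝)) cv
...   | inj₁ w∈S = S-indep c (trans (sym (sumSet-cong c∩[S∪v]≐c∩S)) Σ≡𝟎) w w∈S
  where
  c∩[S∪v]≐c∩S : c ∩ (S ∪ ｛ v ｝) ≐ c ∩ S
  c∩[S∪v]≐c∩S u = trans (∩-∪｛｝ {c = c} {S = S} cv u) (∨-identityʳ _)

∉span-∖｛｝ : LinIndep S → u ∈ S → ¬ Span (S ∖ ｛ u ｝) u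
∉span-∖｛｝ {S = S} S-indep u∈S u∈span =
  span⇒dependent u∈span (∖｛｝-∌ S _)
    (LinIndep-⊆ (≐⇒⊆ (∖｛｝-∪｛｝ {S = S} u∈S)) S-indep)

IsBasis-replace : IsBasis S → u ∈ S → ¬ Span (S ∖ ｛ u ｝) v → IsBasis (replace S u v)
IsBasis-replace {r} {S = S} {u = u} {v = v} (|S|≡r , S-indep) u∈S v∉span =
  card-replace , LinIndep-∪｛｝ (LinIndep-⊆ (∖｛｝-⊆ {S = S} {u = u}) S-indep) v∉span
  where
  card-replace : card (replace S u v) ≡ r
  card-replace = begin
    card ((S ∖ ｛ u ｝) ∪ ｛ v ｝)  ≡⟨ card-∪｛｝ {S = S ∖ ｛ u ｝} (Bool.¬-not (v∉span ∘ ∈⇒span)) ⟩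
    suc (card (S ∖ ｛ u ｝))       ≡⟨ card-∖｛｝ {S = S} u∈S ⟨
    card S                       ≡⟨ |S|≡r ⟩
    r                            ∎
    where open ≡-Reasoning

LinIndep-replace⇒∉span : LinIndep (replace S u v) → ¬ v ∈ S → ¬ Span (S ∖ ｛ u ｝) v
LinIndep-replace⇒∉span {S = S} {u = u} indep v∉S v∈span =
  span⇒dependent v∈span (Bool.¬-not (v∉S ∘ ∖｛｝-⊆ {S = S} {u = u})) indep

-- The exchange step

empty⊎IsMin : {P : GF2^ r → Set} → Decidable P → (∀ v → ¬ P v) ⊎ ∃ (IsMin P)
empty⊎IsMin {r} {P} P? with filter P? (allVecs r) in eq
... | [] = inj₁ λ v Pv → contradiction (subst (v ∈ˡ_) eq (∈-filter⁺ P? (allVecs-complete v) Pv)) λ ()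
... | m ∷ ms = inj₂ (argmin bin m ms , argmin-all bin (All.head P[m∷ms]) (All.tail P[m∷ms]) , minimal)
  where
  P[m∷ms] : All P (m ∷ ms)
  P[m∷ms] = subst (All P) eq (all-filter P? (allVecs r))
  minimal : ∀ z → P z → bin (argmin bin m ms) ≤ bin z
  minimal z Pz with subst (z ∈ˡ_) eq (∈-filter⁺ P? (allVecs-complete z) Pz)
  ... | here refl  = f[argmin]≤f[⊤] {f = bin} m ms
  ... | there z∈ms = All.lookup (f[argmin]≤f[xs] {f = bin} m ms) z∈ms

∃IsY' : {B : Subset r} → IsBasis B → ¬ (∀ v → B v ≡ Rset r v) → ∃ (IsY' B)
∃IsY' {r} {B} B-basis B≢R with empty⊎IsMin (λ v → (B ∖ Rset r) v Bool.≟ true)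
... | inj₂ y-min = y-min
... | inj₁ B∖R-empty = contradiction (⊆-antisym B⊆R R⊆B) B≢R
  where
  B⊆R : B ⊆ Rset r
  B⊆R {v} v∈B with Rset r v in v∉R
  ... | true  = refl
  ... | false = contradiction (cong₂ (λ a b → a ∧ not b) v∈B v∉R) (B∖R-empty v)
  R⊆B : Rset r ⊆ B
  R⊆B = ⊆∧card≥⇒⊇ {S = B} B⊆R (≤-reflexive (trans (card-Rset r) (sym (proj₁ B-basis))))

module _ {B : Subset r} (B-basis : IsBasis B) {y : GF2^ r} (y∈B∖R : y ∈ (B ∖ Rset r)) where

  private
    y∈B : y ∈ B
    y∈B = proj₁ (∈∖⇒ {S = B} {T = Rset r} y∈B∖R)
    y∉R : Rset r y ≡ false
    y∉R = proj₂ (∈∖⇒ {S = B} {T = Rset r} y∈B∖R)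

  ExIn⇔∉span : v ∈ Rset r → ExIn B y v ⇔ (¬ Span (B ∖ ｛ y ｝) v)
  ExIn⇔∉span {v = v} v∈R = mk⇔ to from
    where
    v≢y : v ≢ y
    v≢y refl = contradiction (trans (sym v∈R) y∉R) λ ()
    to : ExIn B y v → ¬ Span (B ∖ ｛ y ｝) v
    to (inj₁ (v∉B , _ , indep)) = LinIndep-replace⇒∉span indep v∉B
    to (inj₂ v≡y) = contradiction v≡y v≢y
    from : ¬ Span (B ∖ ｛ y ｝) v → ExIn B y v
    from v∉span = inj₁ (v∉B , IsBasis-replace B-basis y∈B v∉span)
      where
      v∉B : ¬ v ∈ B
      v∉B v∈B = v∉span (∈⇒span (∈∖｛｝ {S = B} v∈B v≢y))

  R⊈span : ¬ (∀ v → ¬ (v ∈ Rset r × ¬ Span (B ∖ ｛ y ｝) v))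
  R⊈span R⊆span = ∉span-∖｛｝ (proj₂ B-basis) y∈B (span-units⇒span-all units-spanned y)
    where
    units-spanned : ∀ i → Span (B ∖ ｛ y ｝) (unit i)
    units-spanned i with Span? (B ∖ ｛ y ｝) (unit i)
    ... | yes unit∈span = unit∈span
    ... | no unit∉span  = contradiction (Rset-unit i , unit∉span) (R⊆span (unit i))

  ∃IsX' : ∃ (IsX' B y)
  ∃IsX' with empty⊎IsMin (λ v → (Rset r v Bool.≟ true) ×-dec Dec.¬? (Span? (B ∖ ｛ y ｝) v))
  ... | inj₁ R⊆span = contradiction R⊆span R⊈span
  ... | inj₂ (x , (x∈R , x∉span) , x-min) =
    x , (x∈R , Equivalence.from (ExIn⇔∉span x∈R) x∉span) ,
    λ z (z∈R , z-exchangeable) → x-min z (z∈R , Equivalence.to (ExIn⇔∉span z∈R) z-exchangeable)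

ExIn⇒∉ : ExIn S u v → v ∈ T → T u ≡ false → S v ≡ false
ExIn⇒∉ (inj₁ (v∉S , _)) _ _ = Bool.¬-not v∉S
ExIn⇒∉ (inj₂ refl) v∈T u∉T = contradiction (trans (sym v∈T) u∉T) λ ()

card-parent : {B : Subset r} {y x : GF2^ r} → IsY' B y → IsX' B y x →
              card (parentOf B y x ∩ Rset r) ≡ card (B ∩ Rset r) + 1
card-parent {r} {B} (y∈B∖R , _) ((x∈R , x-exchangeable) , _) =
  card-replace-∩ {T = Rset r} y∉R x∈R (ExIn⇒∉ {T = Rset r} x-exchangeable x∈R y∉R)
  where
  y∉R : Rset r _ ≡ false
  y∉R = proj₂ (∈∖⇒ {S = B} {T = Rset r} y∈B∖R)

lemma14 : (r : ℕ) → 1 ≤ r → (B : Subset r) → IsBasis B → ¬ (∀ v → B v ≡ Rset r v) →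
    (∃₂ λ y' x' → IsY' B y' × IsX' B y' x')
    × (∀ y' x' → IsY' B y' → IsX' B y' x' →
    card (parentOf B y' x' ∩ Rset r) ≡ card (B ∩ Rset r) + 1)
lemma14 r _ B B-basis B≢R with ∃IsY' B-basis B≢R
... | y , y-min with ∃IsX' B-basis (proj₁ y-min)
...   | x , x-min = (y , x , y-min , x-min) , λ _ _ → card-parent
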